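{- Identify the vertices of ordered forests in $\mathcal{F}_{\mathrm{ord}}(n)$ with their preorder traversal labels, and fix $p\in(0,1]$. Then: (a) For any ordered forest and any vertex $v$, the labels of $v$ and its descendants form a contiguous subset of $[n]$. (b) For $m\in[n]$ and $F\in\mathcal{F}_{\mathrm{ord}}(n)$, let $F\langle m,n\rangle$ be the induced ordered subforest on the vertices with labels in $[m,n]$. Let $G\in\mathcal{F}_{\mathrm{ord}}(n-m+1)$ be isomorphic to $F\langle m,n\rangle$ and let $G'\in\mathcal{F}_{\mathrm{ord}}(n-m+1)$ be arbitrary. Then the probability that a random Ungar move applied to $F$ produces a forest $F'$ with $F'\langle m,n\rangle\cong G'$ equals the probability that a random Ungar move applied to $G$ produces $G'$. (c) Let $k<l$ be vertices, and consider an infinite sequence of Ungar moves applied starting from $\hat 1$ (the path $1\to2\to\cdots\to n$). For each vertex $i$ let $h_i$ be the smallest $t$ such that $i$ is selected (receives an operation) in the $t$-th move (these minima assumed to exist). If $h_k>h_l$ and $h_l\ge h_i$ for all $i\in[k+1,l-1]$, then after $h_l$ moves, $l$ is a child of $k$.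
   Context: An ordered forest is a forest of rooted trees with the children of each vertex ordered left to right and the trees ordered left to right; $\mathcal{F}_{\mathrm{ord}}(n)$ is the set of such forests on $n$ vertices up to isomorphism. The preorder traversal labels the root of the leftmost tree $1$, and lists each vertex before its subtrees, which are visited left to right, then proceeds to the next tree. Operation on vertex $v$ gives $F[v]$: if $v$ is a leaf, $F[v]=F$; otherwise, with $v'$ the rightmost child of $v$, delete the edge $v\to v'$ and make $v'$ a child of the parent $w$ of $v$ placed immediately right of $v$ (if $w$ exists), or make the tree rooted at $v'$ a new tree placed immediately right of the tree containing $v$ (if $v$ is a root); labels are preserved by operations. An Ungar move selects a set of vertices $i_1<\dots<i_m$ and maps $F\mapsto(\cdots(F[i_1])\cdots)[i_m]$ (operations applied in increasing label order); a selected vertex is said to receive an operation. A random Ungar move with parameter $p$ selects each vertex independently with probability $p$ (this coincides with a random Ungar move in the lattice $(\mathcal{F}_{\mathrm{ord}}(n),\le)$, the Tamari lattice, where $\le$ is generated by $F[v]\le F$). The induced subforest $F\langle m,n\rangle$ is the subgraph on labels $[m,n]$ with the orderings inherited from $F$ (its trees ordered by the labels of their roots).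
   Formalization: The parameter p of the random Ungar moves in part (b) ranges over the rationals in $(0,1]$. -}

module Defs where

open import Data.Nat using (ℕ; zero; suc; _+_; _∸_; _≤_; _<_; _<ᵇ_)
open import Data.Bool using (Bool; true; false; if_then_else_; _∧_)
open import Data.List using (List; []; _∷_; _++_; map)
open import Data.Maybe using (Maybe; just; nothing)
open import Data.Product using (_×_; _,_)
open import Data.Vec using (Vec; toList)
open import Relation.Binary.PropositionalEquality using (_≡_)
open import Data.Rational using (ℚ; 0ℚ; 1ℚ) renaming (_+_ to _+ℚ_; _*_ to _*ℚ_; _-_ to _-ℚ_)

-- This datatype represents ordered forests exactly up to isomorphism, so
-- "isomorphic" ordered forests are *equal* elements of Forest.

data Tree : Set where
  node : List Tree → Tree

Forest : Set
Forest = List Tree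

mutual
  size : Tree → ℕ
  size (node cs) = suc (sizeF cs)

  sizeF : Forest → ℕ
  sizeF []       = 0
  sizeF (t ∷ ts) = size t + sizeF ts

InFord : ℕ → Forest → Set
InFord n F = sizeF F ≡ n

mutual
  eqT : Tree → Tree → Bool
  eqT (node cs) (node ds) = eqF cs ds

  eqF : Forest → Forest → Bool
  eqF []       []       = true
  eqF []       (_ ∷ _)  = false
  eqF (_ ∷ _)  []       = false
  eqF (t ∷ ts) (u ∷ us) = eqT t u ∧ eqF ts us

hat1 : ℕ → Forest
hat1 zero    = []
hat1 (suc n) = node (hat1 n) ∷ []

-- Vertices are identified with their preorder labels 1..n.  Internally we
-- address vertices by preorder *index* (label - 1).

nth : {A : Set} → List A → ℕ → Maybe A
nth []       _       = nothing
nth (x ∷ _)  zero    = just x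
nth (_ ∷ xs) (suc k) = nth xs k

-- List of parent labels in preorder: the j-th entry (0-based) is the
-- parent label of the vertex with label j+1 (nothing for roots).
mutual
  parentsT : ℕ → Maybe ℕ → Tree → List (Maybe ℕ)
  parentsT lbl par (node cs) = par ∷ parentsF (suc lbl) (just lbl) cs

  parentsF : ℕ → Maybe ℕ → Forest → List (Maybe ℕ)
  parentsF lbl par []       = []
  parentsF lbl par (t ∷ ts) = parentsT lbl par t ++ parentsF (lbl + size t) par ts

parentList : Forest → List (Maybe ℕ)
parentList F = parentsF 1 nothing F

IsChild : Forest → ℕ → ℕ → Set
IsChild F k l = nth (parentList F) (l ∸ 1) ≡ just (just k)

data DescOrSelf (F : Forest) (v : ℕ) : ℕ → Set where
  self : DescOrSelf F v v
  step : ∀ {u w} → DescOrSelf F v u → IsChild F u w → DescOrSelf F v w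

-- The operation F[v].  opF k F performs the operation on the vertex of
-- preorder index k (label k+1).  opT k t returns the list of trees that
-- replaces t inside its parent's child list (or inside the forest).
-- The operation does not change the preorder order of vertices, so the
-- preorder labels of F[v] agree with the (preserved) labels of F.

splitLast : List Tree → Maybe (List Tree × Tree)
splitLast []       = nothing
splitLast (c ∷ cs) with splitLast cs
... | nothing          = just ([] , c)
... | just (ini , lst) = just (c ∷ ini , lst)

mutual
  opT : ℕ → Tree → Forest
  opT zero (node cs) with splitLast cs
  ... | nothing         = node cs ∷ []
  ... | just (ini , v') = node ini ∷ v' ∷ []
  opT (suc k) (node cs) = node (opF k cs) ∷ []

  opF : ℕ → Forest → Forest
  opF k []       = []
  opF k (t ∷ ts) with k <ᵇ size t
  ... | true  = opT k t ++ ts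
  ... | false = t ∷ opF (k ∸ size t) ts

operate : Forest → ℕ → Forest
operate F v = opF (v ∸ 1) F

-- Ungar move: the i-th entry (0-based) of the selection says whether the
-- vertex with label i+1 is selected; operations are applied in increasing
-- label order.
ungarFrom : ℕ → Forest → List Bool → Forest
ungarFrom i F []            = F
ungarFrom i F (true  ∷ bs) = ungarFrom (suc i) (operate F (suc i)) bs
ungarFrom i F (false ∷ bs) = ungarFrom (suc i) F bs

ungar : Forest → List Bool → Forest
ungar F s = ungarFrom 0 F s

Selected : List Bool → ℕ → Bool → Set
Selected s i b = nth s (i ∸ 1) ≡ just b

selections : ℕ → List (List Bool)
selections zero    = [] ∷ []
selections (suc n) = map (true ∷_) (selections n) ++ map (false ∷_) (selections n)

weight : ℚ → List Bool → ℚ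
weight p []           = 1ℚ
weight p (true  ∷ s) = p *ℚ weight p s
weight p (false ∷ s) = (1ℚ -ℚ p) *ℚ weight p s

sumℚ : List ℚ → ℚ
sumℚ []       = 0ℚ
sumℚ (x ∷ xs) = x +ℚ sumℚ xs

probRU : ℚ → ℕ → Forest → (Forest → Bool) → ℚ
probRU p n F P =
  sumℚ (map (λ s → weight p s *ℚ (if P (ungar F s) then 1ℚ else 0ℚ)) (selections n))

-- Induced subforest F⟨m,n⟩ (n = number of vertices of F): obtained by
-- deleting the vertices with labels 1..m-1.  Since these form a prefix of
-- the preorder, deleting a vertex whose subtree is only partially deleted
-- makes its surviving descendants-subtrees roots, and roots remain ordered
-- by label (= left to right).

mutual
  dropT : ℕ → Tree → Forest
  dropT zero    t         = t ∷ []
  dropT (suc k) (node cs) = dropF k cs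

  dropF : ℕ → Forest → Forest
  dropF k []       = []
  dropF k (t ∷ ts) with k <ᵇ size t
  ... | true  = dropT k t ++ ts
  ... | false = dropF (k ∸ size t) ts

induced : ℕ → Forest → Forest
induced m F = dropF (m ∸ 1) F

-- Infinite sequences of Ungar moves from \hat 1.  σ t is the selection of
-- the t-th move (t = 1, 2, ...; σ 0 is unused).

stateAfter : (n : ℕ) → (ℕ → Vec Bool n) → ℕ → Forest
stateAfter n σ zero    = hat1 n
stateAfter n σ (suc t) = ungar (stateAfter n σ t) (toList (σ (suc t)))

IsFirstHit : (n : ℕ) → (ℕ → Vec Bool n) → ℕ → ℕ → Set
IsFirstHit n σ i h =
  (1 ≤ h) × Selected (toList (σ h)) i true ×
  (∀ t → 1 ≤ t → t < h → Selected (toList (σ t)) i false)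

-- Operations never change preorder labels: the rightmost child v' of v is moved to just
-- after the rest of the subtree of v, which is where its subtree already sits in preorder.
-- So everything can be read off the list of parent labels.
-- (a) A vertex lying in preorder between a vertex w and its parent u has a parent that is
-- at least u, so climbing through parents from it reaches u.
-- (b) The labels below m form a prefix of the preorder; operations on the prefix do not affect
-- F⟨m,n⟩ and the other operations commute with deleting it, so the prefix coordinates of the
-- selection sum out, as p + (1 - p) = 1.
-- (c) Call a vertex alive until it receives an operation. Starting from the path, the alive
-- vertices always form a path along last children, every other vertex being dead. In move h_l,
-- when l is reached, k and l are alive and everything between them is dead, so l is a child
-- of k; the remaining operations of that move act on vertices ≥ l and keep the parent of l.

module Submission where

open import Defs
open import Data.Bool using (Bool; true; false; if_then_else_; not; _∧_; _∨_)
open import Data.Bool.Properties using (∧-assoc; ∧-identityʳ; ∧-zeroʳ; ∨-identityʳ; ∨-zeroʳ)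
open import Data.List using (List; []; _∷_; _++_; map; drop; take; length)
import Data.List.Properties as List
open import Data.Maybe using (Maybe; just; nothing)
open import Data.Maybe.Properties using (just-injective)
open import Data.Nat using (ℕ; zero; suc; _+_; _∸_; _≤_; _<_; _<ᵇ_; _≡ᵇ_; z≤n; s≤s; z<s)
open import Data.Nat.Properties
open import Data.Nat.Induction using (<-rec)
open import Data.Product using (_×_; _,_; ∃; proj₁; proj₂)
open import Data.Rational using (ℚ; 0ℚ; 1ℚ; -_)
  renaming (_+_ to _+ℚ_; _*_ to _*ℚ_; _-_ to _-ℚ_; _≤_ to _≤ℚ_; _<_ to _<ℚ_)
import Data.Rational.Properties as ℚ
open import Data.Vec using (Vec; toList)
import Data.Vec.Properties as Vec
open import Data.Sum using (_⊎_; inj₁; inj₂)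
open import Function using (_∘_)
open import Relation.Binary.PropositionalEquality
open import Relation.Nullary using (contradiction)
open import Relation.Nullary.Reflects using (ofʸ; ofⁿ)

opF-∷-< : ∀ {k t} ts → k < size t → opF k (t ∷ ts) ≡ opT k t ++ ts
opF-∷-< {k} {t} ts k<t with k <ᵇ size t | <ᵇ-reflects-< k (size t)
... | true  | _       = refl
... | false | ofⁿ k≮t = contradiction k<t k≮t

opF-∷-≥ : ∀ {k t} ts → size t ≤ k → opF k (t ∷ ts) ≡ t ∷ opF (k ∸ size t) ts
opF-∷-≥ {k} {t} ts t≤k with k <ᵇ size t | <ᵇ-reflects-< k (size t)
... | true  | ofʸ k<t = contradiction t≤k (<⇒≱ k<t)
... | false | _       = refl

dropF-∷-< : ∀ {k t} ts → k < size t → dropF k (t ∷ ts) ≡ dropT k t ++ ts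
dropF-∷-< {k} {t} ts k<t with k <ᵇ size t | <ᵇ-reflects-< k (size t)
... | true  | _       = refl
... | false | ofⁿ k≮t = contradiction k<t k≮t

dropF-∷-≥ : ∀ {k t} ts → size t ≤ k → dropF k (t ∷ ts) ≡ dropF (k ∸ size t) ts
dropF-∷-≥ {k} {t} ts t≤k with k <ᵇ size t | <ᵇ-reflects-< k (size t)
... | true  | ofʸ k<t = contradiction t≤k (<⇒≱ k<t)
... | false | _       = refl

data SplitLast : List Tree → Maybe (List Tree × Tree) → Set where
  empty : SplitLast [] nothing
  snoc  : ∀ ini c → SplitLast (ini ++ c ∷ []) (just (ini , c))

splitLast-view : ∀ cs → SplitLast cs (splitLast cs)
splitLast-view []       = empty
splitLast-view (c ∷ cs) with splitLast cs | splitLast-view cs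
... | nothing         | empty        = snoc [] c
... | just (ini , l)  | snoc .ini .l = snoc (c ∷ ini) l

splitLast-snoc : ∀ cs t → splitLast (cs ++ t ∷ []) ≡ just (cs , t)
splitLast-snoc []       t = refl
splitLast-snoc (c ∷ cs) t rewrite splitLast-snoc cs t = refl

sizeF-++ : ∀ xs ys → sizeF (xs ++ ys) ≡ sizeF xs + sizeF ys
sizeF-++ []       ys = refl
sizeF-++ (t ∷ xs) ys = trans (cong (size t +_) (sizeF-++ xs ys)) (sym (+-assoc (size t) (sizeF xs) (sizeF ys)))

sizeF-snoc : ∀ ts G → sizeF (ts ++ node G ∷ []) ≡ suc (sizeF ts + sizeF G)
sizeF-snoc ts G = begin
  sizeF (ts ++ node G ∷ [])        ≡⟨ sizeF-++ ts (node G ∷ []) ⟩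
  sizeF ts + (suc (sizeF G) + 0)   ≡⟨ cong (sizeF ts +_) (+-identityʳ _) ⟩
  sizeF ts + suc (sizeF G)         ≡⟨ +-suc (sizeF ts) (sizeF G) ⟩
  suc (sizeF ts + sizeF G)         ∎
  where open ≡-Reasoning

mutual
  sizeF-opT : ∀ k t → sizeF (opT k t) ≡ size t
  sizeF-opT zero (node cs) with splitLast cs | splitLast-view cs
  ... | nothing        | empty        = refl
  ... | just (ini , c) | snoc .ini .c = cong suc (sym (sizeF-++ ini (c ∷ [])))
  sizeF-opT (suc k) (node cs) = cong suc (trans (+-identityʳ _) (sizeF-opF k cs))

  sizeF-opF : ∀ k F → sizeF (opF k F) ≡ sizeF F
  sizeF-opF k [] = refl
  sizeF-opF k (t ∷ ts) with <-≤-connex k (size t)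
  ... | inj₁ k<t rewrite opF-∷-< ts k<t | sizeF-++ (opT k t) ts | sizeF-opT k t = refl
  ... | inj₂ t≤k rewrite opF-∷-≥ ts t≤k | sizeF-opF (k ∸ size t) ts = refl

∸-<-shift : ∀ {k s m} → k < s + m → s ≤ k → k ∸ s < m
∸-<-shift {k} {s} {m} k<s+m s≤k = subst (k ∸ s <_) (m+n∸m≡n s m) (∸-monoˡ-< k<s+m s≤k)

∸-≤-shift : ∀ {k s m} → k ≤ s + m → k ∸ s ≤ m
∸-≤-shift {k} {s} {m} k≤s+m = subst (k ∸ s ≤_) (m+n∸m≡n s m) (∸-monoˡ-≤ s k≤s+m)

≤-∸-shift : ∀ {s m k} → s + m ≤ k → m ≤ k ∸ s
≤-∸-shift {s} {m} {k} s+m≤k = subst (_≤ k ∸ s) (m+n∸m≡n s m) (∸-monoˡ-≤ s s+m≤k)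

opF-++ˡ : ∀ k xs ys → k < sizeF xs → opF k (xs ++ ys) ≡ opF k xs ++ ys
opF-++ˡ k (t ∷ xs) ys k<xs with <-≤-connex k (size t)
... | inj₁ k<t rewrite opF-∷-< (xs ++ ys) k<t | opF-∷-< xs k<t = sym (List.++-assoc (opT k t) xs ys)
... | inj₂ t≤k rewrite opF-∷-≥ (xs ++ ys) t≤k | opF-∷-≥ xs t≤k =
  cong (t ∷_) (opF-++ˡ (k ∸ size t) xs ys (∸-<-shift k<xs t≤k))

opF-++ʳ : ∀ k xs ys → sizeF xs ≤ k → opF k (xs ++ ys) ≡ xs ++ opF (k ∸ sizeF xs) ys
opF-++ʳ k []       ys _     = refl
opF-++ʳ k (t ∷ xs) ys xs≤k
  rewrite opF-∷-≥ (xs ++ ys) (≤-trans (m≤m+n (size t) (sizeF xs)) xs≤k)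
        | opF-++ʳ (k ∸ size t) xs ys (≤-∸-shift xs≤k)
        | ∸-+-assoc k (size t) (sizeF xs) = refl

opF-beyond : ∀ k F → sizeF F ≤ k → opF k F ≡ F
opF-beyond k F F≤k = begin
  opF k F            ≡⟨ cong (opF k) (List.++-identityʳ F) ⟨
  opF k (F ++ [])    ≡⟨ opF-++ʳ k F [] F≤k ⟩
  F ++ []            ≡⟨ List.++-identityʳ F ⟩
  F                  ∎
  where open ≡-Reasoning

dropF-zero : ∀ F → dropF 0 F ≡ F
dropF-zero []           = refl
dropF-zero (node _ ∷ _) = refl

dropF-++ˡ : ∀ k xs ys → k ≤ sizeF xs → dropF k (xs ++ ys) ≡ dropF k xs ++ ys
dropF-++ˡ zero [] ys z≤n = dropF-zero ys
dropF-++ˡ k (t ∷ xs) ys k≤xs with <-≤-connex k (size t)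
... | inj₁ k<t rewrite dropF-∷-< (xs ++ ys) k<t | dropF-∷-< xs k<t = sym (List.++-assoc (dropT k t) xs ys)
... | inj₂ t≤k rewrite dropF-∷-≥ (xs ++ ys) t≤k | dropF-∷-≥ xs t≤k =
  dropF-++ˡ (k ∸ size t) xs ys (∸-≤-shift k≤xs)

dropF-++ʳ : ∀ k xs ys → sizeF xs ≤ k → dropF k (xs ++ ys) ≡ dropF (k ∸ sizeF xs) ys
dropF-++ʳ k []       ys _ = refl
dropF-++ʳ k (t ∷ xs) ys xs≤k
  rewrite dropF-∷-≥ (xs ++ ys) (≤-trans (m≤m+n (size t) (sizeF xs)) xs≤k)
        | dropF-++ʳ (k ∸ size t) xs ys (≤-∸-shift xs≤k)
        | ∸-+-assoc k (size t) (sizeF xs) = refl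

dropF-root : ∀ j xs ys → dropF (suc j) (node xs ∷ ys) ≡ dropF j (xs ++ ys)
dropF-root j xs ys with <-≤-connex j (sizeF xs)
... | inj₁ j<xs rewrite dropF-∷-< {t = node xs} ys (s≤s j<xs) = sym (dropF-++ˡ j xs ys (<⇒≤ j<xs))
... | inj₂ xs≤j rewrite dropF-∷-≥ {t = node xs} ys (s≤s xs≤j) = sym (dropF-++ʳ j xs ys xs≤j)

dropF-opF-root : ∀ j k xs ys → dropF (suc j) (opF (suc k) (node xs ∷ ys)) ≡ dropF j (opF k (xs ++ ys))
dropF-opF-root j k xs ys with <-≤-connex k (sizeF xs)
... | inj₁ k<xs rewrite opF-∷-< {t = node xs} ys (s≤s k<xs) | opF-++ˡ k xs ys k<xs = dropF-root j (opF k xs) ys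
... | inj₂ xs≤k rewrite opF-∷-≥ {t = node xs} ys (s≤s xs≤k) | opF-++ʳ k xs ys xs≤k =
  dropF-root j xs (opF (k ∸ sizeF xs) ys)

dropF-opF-< : ∀ j k F → k < j → dropF j (opF k F) ≡ dropF j F
dropF-opF-< j k [] _ = refl
dropF-opF-< (suc j) zero (node xs ∷ ys) _ with splitLast xs | splitLast-view xs
... | nothing        | empty        = refl
... | just (ini , c) | snoc .ini .c = begin
  dropF (suc j) (node ini ∷ c ∷ ys)   ≡⟨ dropF-root j ini (c ∷ ys) ⟩
  dropF j (ini ++ c ∷ ys)             ≡⟨ cong (dropF j) (List.++-assoc ini (c ∷ []) ys) ⟨
  dropF j ((ini ++ c ∷ []) ++ ys)     ≡⟨ dropF-root j (ini ++ c ∷ []) ys ⟨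
  dropF (suc j) (node (ini ++ c ∷ []) ∷ ys) ∎
  where open ≡-Reasoning
dropF-opF-< (suc j) (suc k) (node xs ∷ ys) (s≤s k<j) = begin
  dropF (suc j) (opF (suc k) (node xs ∷ ys))  ≡⟨ dropF-opF-root j k xs ys ⟩
  dropF j (opF k (xs ++ ys))                  ≡⟨ dropF-opF-< j k (xs ++ ys) k<j ⟩
  dropF j (xs ++ ys)                          ≡⟨ dropF-root j xs ys ⟨
  dropF (suc j) (node xs ∷ ys)                ∎
  where open ≡-Reasoning

dropF-opF-+ : ∀ j k F → dropF j (opF (j + k) F) ≡ opF k (dropF j F)
dropF-opF-+ zero k F rewrite dropF-zero F = dropF-zero (opF k F)
dropF-opF-+ (suc j) k [] = refl
dropF-opF-+ (suc j) k (node xs ∷ ys) = begin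
  dropF (suc j) (opF (suc j + k) (node xs ∷ ys))  ≡⟨ dropF-opF-root j (j + k) xs ys ⟩
  dropF j (opF (j + k) (xs ++ ys))                ≡⟨ dropF-opF-+ j k (xs ++ ys) ⟩
  opF k (dropF j (xs ++ ys))                      ≡⟨ cong (opF k) (dropF-root j xs ys) ⟨
  opF k (dropF (suc j) (node xs ∷ ys))            ∎
  where open ≡-Reasoning

dropF-ungarFrom-+ : ∀ j i F bs → dropF j (ungarFrom (j + i) F bs) ≡ ungarFrom i (dropF j F) bs
dropF-ungarFrom-+ j i F [] = refl
dropF-ungarFrom-+ j i F (true ∷ bs) rewrite sym (+-suc j i)
  | dropF-ungarFrom-+ j (suc i) (opF (j + i) F) bs | dropF-opF-+ j i F = refl
dropF-ungarFrom-+ j i F (false ∷ bs) rewrite sym (+-suc j i) = dropF-ungarFrom-+ j (suc i) F bs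

-- Operations on the deleted prefix are invisible; the others commute with deletion.
dropF-ungarFrom : ∀ i d F s → dropF (i + d) (ungarFrom i F s) ≡ ungar (dropF (i + d) F) (drop d s)
dropF-ungarFrom i zero F s rewrite +-identityʳ i =
  subst (λ z → dropF i (ungarFrom z F s) ≡ ungar (dropF i F) s) (+-identityʳ i) (dropF-ungarFrom-+ i 0 F s)
dropF-ungarFrom i (suc d) F [] = refl
dropF-ungarFrom i (suc d) F (true ∷ s) rewrite +-suc i d
  | dropF-ungarFrom (suc i) d (opF i F) s | dropF-opF-< (suc (i + d)) i F (s≤s (m≤m+n i d)) = refl
dropF-ungarFrom i (suc d) F (false ∷ s) rewrite +-suc i d = dropF-ungarFrom (suc i) d F s

dropF-ungar : ∀ j F s → dropF j (ungar F s) ≡ ungar (dropF j F) (drop j s)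
dropF-ungar j F s = dropF-ungarFrom 0 j F s

sumℚ-++ : ∀ xs ys → sumℚ (xs ++ ys) ≡ sumℚ xs +ℚ sumℚ ys
sumℚ-++ []       ys = sym (ℚ.+-identityˡ (sumℚ ys))
sumℚ-++ (x ∷ xs) ys rewrite sumℚ-++ xs ys = sym (ℚ.+-assoc x (sumℚ xs) (sumℚ ys))

sumℚ-*ˡ : ∀ {A : Set} c (f : A → ℚ) xs → sumℚ (map (λ x → c *ℚ f x) xs) ≡ c *ℚ sumℚ (map f xs)
sumℚ-*ˡ c f []       = sym (ℚ.*-zeroʳ c)
sumℚ-*ˡ c f (x ∷ xs) rewrite sumℚ-*ˡ c f xs = sym (ℚ.*-distribˡ-+ c (f x) (sumℚ (map f xs)))

p+[1-p]≡1 : ∀ p → p +ℚ (1ℚ -ℚ p) ≡ 1ℚ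
p+[1-p]≡1 p = begin
  p +ℚ (1ℚ +ℚ - p)   ≡⟨ cong (p +ℚ_) (ℚ.+-comm 1ℚ (- p)) ⟩
  p +ℚ (- p +ℚ 1ℚ)   ≡⟨ ℚ.+-assoc p (- p) 1ℚ ⟨
  (p +ℚ - p) +ℚ 1ℚ   ≡⟨ cong (_+ℚ 1ℚ) (ℚ.+-inverseʳ p) ⟩
  0ℚ +ℚ 1ℚ           ≡⟨ ℚ.+-identityˡ 1ℚ ⟩
  1ℚ                 ∎
  where open ≡-Reasoning

expectation : ℚ → ℕ → (List Bool → ℚ) → ℚ
expectation p n g = sumℚ (map (λ s → weight p s *ℚ g s) (selections n))

-- The first coordinate of a selection contributes p + (1 - p) = 1.
expectation-drop : ∀ p j r g → expectation p (j + r) (g ∘ drop j) ≡ expectation p r g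
expectation-drop p zero    r g = refl
expectation-drop p (suc j) r g = begin
  sumℚ (map f (map (true ∷_) S ++ map (false ∷_) S))
    ≡⟨ cong sumℚ (List.map-++ f (map (true ∷_) S) (map (false ∷_) S)) ⟩
  sumℚ (map f (map (true ∷_) S) ++ map f (map (false ∷_) S))
    ≡⟨ sumℚ-++ (map f (map (true ∷_) S)) (map f (map (false ∷_) S)) ⟩
  sumℚ (map f (map (true ∷_) S)) +ℚ sumℚ (map f (map (false ∷_) S))
    ≡⟨ cong₂ _+ℚ_ (branch true p (λ _ → refl)) (branch false (1ℚ -ℚ p) (λ _ → refl)) ⟩
  p *ℚ E +ℚ (1ℚ -ℚ p) *ℚ E
    ≡⟨ ℚ.*-distribʳ-+ E p (1ℚ -ℚ p) ⟨
  (p +ℚ (1ℚ -ℚ p)) *ℚ E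
    ≡⟨ cong (_*ℚ E) (p+[1-p]≡1 p) ⟩
  1ℚ *ℚ E
    ≡⟨ ℚ.*-identityˡ E ⟩
  E
    ≡⟨ expectation-drop p j r g ⟩
  expectation p r g ∎
  where
  open ≡-Reasoning
  S = selections (j + r)
  f = λ s → weight p s *ℚ g (drop (suc j) s)
  E = expectation p (j + r) (g ∘ drop j)
  branch : ∀ b c → (∀ s → weight p (b ∷ s) ≡ c *ℚ weight p s) →
           sumℚ (map f (map (b ∷_) S)) ≡ c *ℚ E
  branch b c weight-∷ = begin
    sumℚ (map f (map (b ∷_) S))
      ≡⟨ cong sumℚ (List.map-∘ S) ⟨
    sumℚ (map (f ∘ (b ∷_)) S)
      ≡⟨ cong sumℚ (List.map-cong (λ s → trans (cong (_*ℚ g (drop j s)) (weight-∷ s)) (ℚ.*-assoc c _ _)) S) ⟩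
    sumℚ (map (λ s → c *ℚ (weight p s *ℚ g (drop j s))) S)
      ≡⟨ sumℚ-*ˡ c (λ s → weight p s *ℚ g (drop j s)) S ⟩
    c *ℚ E ∎

probRU-dropF : ∀ p j r F (P : Forest → Bool) →
  probRU p (j + r) F (P ∘ dropF j) ≡ probRU p r (dropF j F) P
probRU-dropF p j r F P = begin
  expectation p (j + r) (λ s → indicator (P (dropF j (ungar F s))))
    ≡⟨ cong sumℚ (List.map-cong (λ s → cong (λ G → weight p s *ℚ indicator (P G)) (dropF-ungar j F s))
                                (selections (j + r))) ⟩
  expectation p (j + r) (λ s → indicator (P (ungar (dropF j F) (drop j s))))
    ≡⟨ expectation-drop p j r (λ s → indicator (P (ungar (dropF j F) s))) ⟩
  expectation p r (λ s → indicator (P (ungar (dropF j F) s))) ∎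
  where
  open ≡-Reasoning
  indicator : Bool → ℚ
  indicator b = if b then 1ℚ else 0ℚ

induced-commutes-with-ungar :
  (p : ℚ) (n m : ℕ) → 1 ≤ m → m ≤ n → (F G' : Forest) →
  probRU p n F (λ F' → eqF (induced m F') G')
    ≡ probRU p (n ∸ m + 1) (induced m F) (λ G'' → eqF G'' G')
induced-commutes-with-ungar p n (suc j) _ m≤n F G' =
  subst (λ N → probRU p N F (λ F' → eqF (dropF j F') G')
                ≡ probRU p (n ∸ suc j + 1) (dropF j F) (λ G'' → eqF G'' G'))
    j+[n∸m+1]≡n (probRU-dropF p j (n ∸ suc j + 1) F (λ G'' → eqF G'' G'))
  where
  j+[n∸m+1]≡n : j + (n ∸ suc j + 1) ≡ n
  j+[n∸m+1]≡n = trans (cong (j +_) (+-comm (n ∸ suc j) 1)) (trans (+-suc j (n ∸ suc j)) (m+[n∸m]≡n m≤n))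

+-[∸]-shift : ∀ a {s i} → s ≤ i → a + s + (i ∸ s) ≡ a + i
+-[∸]-shift a {s} {i} s≤i = trans (+-assoc a s (i ∸ s)) (cong (a +_) (m+[n∸m]≡n s≤i))

mutual
  length-parentsT : ∀ lbl par t → length (parentsT lbl par t) ≡ size t
  length-parentsT lbl par (node cs) = cong suc (length-parentsF (suc lbl) (just lbl) cs)

  length-parentsF : ∀ lbl par F → length (parentsF lbl par F) ≡ sizeF F
  length-parentsF lbl par []       = refl
  length-parentsF lbl par (t ∷ ts) = trans (List.length-++ (parentsT lbl par t))
    (cong₂ _+_ (length-parentsT lbl par t) (length-parentsF (lbl + size t) par ts))

parentsF-++ : ∀ lbl par xs ys →
  parentsF lbl par (xs ++ ys) ≡ parentsF lbl par xs ++ parentsF (lbl + sizeF xs) par ys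
parentsF-++ lbl par []       ys = cong (λ l → parentsF l par ys) (sym (+-identityʳ lbl))
parentsF-++ lbl par (t ∷ xs) ys rewrite parentsF-++ (lbl + size t) par xs ys | +-assoc lbl (size t) (sizeF xs) =
  sym (List.++-assoc (parentsT lbl par t) (parentsF (lbl + size t) par xs) _)

nth-++ˡ : ∀ {A : Set} (xs ys : List A) i → i < length xs → nth (xs ++ ys) i ≡ nth xs i
nth-++ˡ (x ∷ xs) ys zero    _         = refl
nth-++ˡ (x ∷ xs) ys (suc i) (s≤s i<xs) = nth-++ˡ xs ys i i<xs

nth-++ʳ : ∀ {A : Set} (xs ys : List A) i → length xs ≤ i → nth (xs ++ ys) i ≡ nth ys (i ∸ length xs)
nth-++ʳ []       ys i       _          = refl
nth-++ʳ (x ∷ xs) ys (suc i) (s≤s xs≤i) = nth-++ʳ xs ys i xs≤i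

nth-< : ∀ {A : Set} (xs : List A) i → i < length xs → ∃ λ y → nth xs i ≡ just y
nth-< (x ∷ xs) zero    _          = x , refl
nth-< (x ∷ xs) (suc i) (s≤s i<xs) = nth-< xs i i<xs

nth-parentsF-∷-< : ∀ lbl par t ts i → i < size t →
  nth (parentsF lbl par (t ∷ ts)) i ≡ nth (parentsT lbl par t) i
nth-parentsF-∷-< lbl par t ts i i<t =
  nth-++ˡ (parentsT lbl par t) _ i (subst (i <_) (sym (length-parentsT lbl par t)) i<t)

nth-parentsF-∷-≥ : ∀ lbl par t ts i → size t ≤ i →
  nth (parentsF lbl par (t ∷ ts)) i ≡ nth (parentsF (lbl + size t) par ts) (i ∸ size t)
nth-parentsF-∷-≥ lbl par t ts i t≤i =
  trans (nth-++ʳ (parentsT lbl par t) _ i (subst (_≤ i) (sym (length-parentsT lbl par t)) t≤i))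
        (cong (λ z → nth (parentsF (lbl + size t) par ts) (i ∸ z)) (length-parentsT lbl par t))

data ParentRange (lbl i : ℕ) (par y : Maybe ℕ) : Set where
  outer : y ≡ par → ParentRange lbl i par y
  inner : ∀ q → y ≡ just q → lbl ≤ q → q < lbl + i → ParentRange lbl i par y

mutual
  parentsT-range : ∀ lbl par t i y → nth (parentsT lbl par t) i ≡ just y → ParentRange lbl i par y
  parentsT-range lbl par (node cs) zero    y eq = outer (sym (just-injective eq))
  parentsT-range lbl par (node cs) (suc i) y eq with parentsF-range (suc lbl) (just lbl) cs i y eq
  ... | outer y≡lbl           = inner lbl y≡lbl ≤-refl (m<m+n lbl z<s)
  ... | inner q y≡q lbl<q q<  = inner q y≡q (≤-trans (n≤1+n lbl) lbl<q) (subst (q <_) (sym (+-suc lbl i)) q<)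

  parentsF-range : ∀ lbl par F i y → nth (parentsF lbl par F) i ≡ just y → ParentRange lbl i par y
  parentsF-range lbl par (t ∷ ts) i y eq with <-≤-connex i (size t)
  ... | inj₁ i<t = parentsT-range lbl par t i y (trans (sym (nth-parentsF-∷-< lbl par t ts i i<t)) eq)
  ... | inj₂ t≤i with parentsF-range (lbl + size t) par ts (i ∸ size t) y
                       (trans (sym (nth-parentsF-∷-≥ lbl par t ts i t≤i)) eq)
  ...   | outer y≡par          = outer y≡par
  ...   | inner q y≡q lbl≤q q< = inner q y≡q (≤-trans (m≤m+n lbl (size t)) lbl≤q)
           (subst (q <_) (+-[∸]-shift lbl t≤i) q<)

ParentBefore : ℕ → Maybe ℕ → Set
ParentBefore lbl par = ∀ p → par ≡ just p → p < lbl

-- A vertex lying in preorder between a vertex j and its parent u is a descendant of u;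
-- only the consequence that its parent is at least u is recorded here.
mutual
  parentsT-between : ∀ lbl par t i j u → ParentBefore lbl par →
    nth (parentsT lbl par t) j ≡ just (just u) → u < lbl + i → i < j →
    ∃ λ q → nth (parentsT lbl par t) i ≡ just (just q) × u ≤ q
  parentsT-between lbl par (node cs) zero (suc j) u _ eq u<lbl _
    with parentsF-range (suc lbl) (just lbl) cs j (just u) eq
  ... | outer u≡lbl = contradiction (just-injective u≡lbl) (<⇒≢ (subst (u <_) (+-identityʳ lbl) u<lbl))
  ... | inner q u≡q lbl<q _ rewrite just-injective u≡q =
        contradiction (subst (q <_) (+-identityʳ lbl) u<lbl) (≤⇒≯ (≤-trans (n≤1+n lbl) lbl<q))
  parentsT-between lbl par (node cs) (suc i) (suc j) u _ eq u< (s≤s i<j) =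
    parentsF-between (suc lbl) (just lbl) cs i j u (λ p lbl≡p → ≤-reflexive (cong suc (just-injective (sym lbl≡p))))
      eq (subst (u <_) (+-suc lbl i) u<) i<j

  parentsF-between : ∀ lbl par F i j u → ParentBefore lbl par →
    nth (parentsF lbl par F) j ≡ just (just u) → u < lbl + i → i < j →
    ∃ λ q → nth (parentsF lbl par F) i ≡ just (just q) × u ≤ q
  parentsF-between lbl par (t ∷ ts) i j u par< eq u< i<j with <-≤-connex j (size t)
  ... | inj₁ j<t rewrite nth-parentsF-∷-< lbl par t ts j j<t | nth-parentsF-∷-< lbl par t ts i (<-trans i<j j<t) =
        parentsT-between lbl par t i j u par< eq u< i<j
  ... | inj₂ t≤j with <-≤-connex i (size t)
  ...   | inj₂ t≤i rewrite nth-parentsF-∷-≥ lbl par t ts j t≤j | nth-parentsF-∷-≥ lbl par t ts i t≤i =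
          parentsF-between (lbl + size t) par ts (i ∸ size t) (j ∸ size t) u
            (λ p e → <-≤-trans (par< p e) (m≤m+n lbl (size t)))
            eq (subst (u <_) (sym (+-[∸]-shift lbl t≤i)) u<)
            (∸-monoˡ-< i<j t≤i)
  ...   | inj₁ i<t rewrite nth-parentsF-∷-< lbl par t ts i i<t
          with parentsF-range (lbl + size t) par ts (j ∸ size t) (just u)
                 (trans (sym (nth-parentsF-∷-≥ lbl par t ts j t≤j)) eq)
  ...     | inner q u≡q lbl+t≤q _ rewrite just-injective u≡q =
            contradiction (<-≤-trans u< (≤-trans (+-monoʳ-≤ lbl (<⇒≤ i<t)) lbl+t≤q)) (n≮n q)
  ...     | outer u≡par with nth-< (parentsT lbl par t) i (subst (i <_) (sym (length-parentsT lbl par t)) i<t)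
  ...       | y , ey with parentsT-range lbl par t i y ey
  ...         | outer y≡par       = u , trans ey (cong just (trans y≡par (sym u≡par))) , ≤-refl
  ...         | inner q y≡q lbl≤q _ = q , trans ey (cong just y≡q) , <⇒≤ (<-≤-trans (par< u (sym u≡par)) lbl≤q)

isChild⇒< : ∀ F {k l} → IsChild F k l → k < l
isChild⇒< F {k} {zero} k→l with parentsF-range 1 nothing F 0 (just k) k→l
... | outer ()
... | inner q k≡q 1≤q q< = contradiction (≤-<-trans 1≤q q<) (n≮n 1)
isChild⇒< F {k} {suc l} k→l with parentsF-range 1 nothing F l (just k) k→l
... | outer ()
... | inner q k≡q _ q< rewrite just-injective k≡q = q<

isChild-between : ∀ F {u w} x → IsChild F u w → u < x → x < w → ∃ λ q → IsChild F q x × u ≤ q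
isChild-between F {u} {suc w} (suc x) u→w u<x (s≤s x<w) =
  parentsF-between 1 nothing F x w u (λ _ ()) u→w u<x x<w

descOrSelf-trans : ∀ {F v u w} → DescOrSelf F v u → DescOrSelf F u w → DescOrSelf F v w
descOrSelf-trans d self       = d
descOrSelf-trans d (step e c) = step (descOrSelf-trans d e) c

descOrSelf⇒≤ : ∀ {F v a} → DescOrSelf F v a → v ≤ a
descOrSelf⇒≤ self       = ≤-refl
descOrSelf⇒≤ {F} (step d c) = ≤-trans (descOrSelf⇒≤ d) (<⇒≤ (isChild⇒< F c))

isChild-between⇒descOrSelf : ∀ F {u w} → IsChild F u w → ∀ x → u < x → x < w → DescOrSelf F u x
isChild-between⇒descOrSelf F {u} {w} u→w = <-rec (λ x → u < x → x < w → DescOrSelf F u x) climb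
  where
  climb : ∀ x → (∀ {y} → y < x → u < y → y < w → DescOrSelf F u y) → u < x → x < w → DescOrSelf F u x
  climb x rec u<x x<w with isChild-between F x u→w u<x x<w
  ... | q , q→x , u≤q with m≤n⇒m<n∨m≡n u≤q
  ...   | inj₂ refl = step self q→x
  ...   | inj₁ u<q  = step (rec (isChild⇒< F q→x) u<q (<-trans (isChild⇒< F q→x) x<w)) q→x

descOrSelf-contiguous : ∀ F {v} a b c → a ≤ b → b ≤ c →
  DescOrSelf F v a → DescOrSelf F v c → DescOrSelf F v b
descOrSelf-contiguous F a b c a≤b b≤c da self with ≤-antisym b≤c (≤-trans (descOrSelf⇒≤ da) a≤b)
... | refl = self
descOrSelf-contiguous F a b c a≤b b≤c da (step {u} d u→c) with <-≤-connex u b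
... | inj₂ b≤u = descOrSelf-contiguous F a b u a≤b b≤u da d
... | inj₁ u<b with m≤n⇒m<n∨m≡n b≤c
...   | inj₂ refl = step d u→c
...   | inj₁ b<c  = descOrSelf-trans d (isChild-between⇒descOrSelf F u→c b u<b b<c)

+-suc-assoc : ∀ a b c → a + suc (b + c) ≡ suc (a + b) + c
+-suc-assoc a b c = trans (+-suc a (b + c)) (cong suc (sym (+-assoc a b c)))

Dead : (ℕ → Bool) → ℕ → ℕ → Set
Dead alive lbl m = ∀ x → lbl ≤ x → x < lbl + m → alive x ≡ false

-- lbl is the label of the first vertex; the alive vertices form a path along last children.
data Spine (alive : ℕ → Bool) : ℕ → Forest → Set where
  dead  : ∀ {lbl ts} → Dead alive lbl (sizeF ts) → Spine alive lbl ts
  spine : ∀ {lbl ts G} → Dead alive lbl (sizeF ts) → alive (lbl + sizeF ts) ≡ true →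
          Spine alive (suc (lbl + sizeF ts)) G → Spine alive lbl (ts ++ node G ∷ [])

spine-resize : ∀ {alive lbl ts G s} → sizeF ts ≡ s → Dead alive lbl s → alive (lbl + s) ≡ true →
               Spine alive (suc (lbl + s)) G → Spine alive lbl (ts ++ node G ∷ [])
spine-resize refl = spine

Dead-mono : ∀ {u u' lbl m} → (∀ x → u x ≡ false → u' x ≡ false) → Dead u lbl m → Dead u' lbl m
Dead-mono u⇒u' d x lbl≤x x< = u⇒u' x (d x lbl≤x x<)

Dead-join : ∀ {u lbl s g} → Dead u lbl s → u (lbl + s) ≡ false → Dead u (suc (lbl + s)) g →
            Dead u lbl (suc (s + g))
Dead-join {u} {lbl} {s} {g} before at after x lbl≤x x< with <-≤-connex x (lbl + s)
... | inj₁ x<  = before x lbl≤x x<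
... | inj₂ ≤x with m≤n⇒m<n∨m≡n ≤x
...   | inj₂ refl = at
...   | inj₁ <x   = after x <x (subst (x <_) (+-suc-assoc lbl s g) x<)

Spine-weaken : ∀ {u u' lbl F} → Spine u lbl F → (∀ x → u x ≡ false → u' x ≡ false) →
               (∀ x → lbl ≤ x → u x ≡ true → u' x ≡ true) → Spine u' lbl F
Spine-weaken (dead d) dead⇒ _ = dead (Dead-mono dead⇒ d)
Spine-weaken {lbl = lbl} (spine {ts = ts} d r S) dead⇒ alive⇒ =
  spine (Dead-mono dead⇒ d) (alive⇒ _ (m≤m+n lbl (sizeF ts)) r)
        (Spine-weaken S dead⇒ (λ x le → alive⇒ x (≤-trans (≤-trans (m≤m+n lbl (sizeF ts)) (n≤1+n _)) le)))

Spine-cong : ∀ {u u' lbl F} → (∀ x → u x ≡ u' x) → Spine u lbl F → Spine u' lbl F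
Spine-cong u≗u' S = Spine-weaken S (λ x e → trans (sym (u≗u' x)) e) (λ x _ e → trans (sym (u≗u' x)) e)

record Kills (u u' : ℕ → Bool) (v : ℕ) : Set where
  field
    dead-stays  : ∀ x → u x ≡ false → u' x ≡ false
    alive-stays : ∀ x → x ≢ v → u x ≡ true → u' x ≡ true
    killed      : u' v ≡ false

opF-zero-snoc : ∀ cs t → opF 0 (node (cs ++ t ∷ []) ∷ []) ≡ node cs ∷ t ∷ []
opF-zero-snoc cs t rewrite splitLast-snoc cs t = refl

opF-suc-root : ∀ k G → opF (suc k) (node G ∷ []) ≡ node (opF k G) ∷ []
opF-suc-root k G with <-≤-connex k (sizeF G)
... | inj₁ k<G rewrite opF-∷-< {t = node G} [] (s≤s k<G) = refl
... | inj₂ G≤k rewrite opF-∷-≥ {t = node G} [] (s≤s G≤k) | opF-beyond k G G≤k = refl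

mutual
  Spine-opF : ∀ {u u'} lbl k F → Spine u lbl F → Kills u u' (lbl + k) → Spine u' lbl (opF k F)
  Spine-opF lbl k F (dead d) K = dead (subst (Dead _ lbl) (sym (sizeF-opF k F)) (Dead-mono dead-stays d))
    where open Kills K
  Spine-opF lbl k .(ts ++ node G ∷ []) (spine {ts = ts} {G} d r S) K with <-≤-connex k (sizeF ts)
  ... | inj₁ k<ts rewrite opF-++ˡ k ts (node G ∷ []) k<ts =
        spine-resize (sizeF-opF k ts) (Dead-mono dead-stays d) (alive-stays _ (>⇒≢ v<root) r)
          (Spine-weaken S dead-stays (λ x le → alive-stays x (>⇒≢ (<-≤-trans (<-trans v<root (n<1+n _)) le))))
    where
    open Kills K
    v<root : lbl + k < lbl + sizeF ts
    v<root = +-monoʳ-< lbl k<ts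
  ... | inj₂ ts≤k rewrite opF-++ʳ k ts (node G ∷ []) ts≤k =
        Spine-opF-last lbl ts G (k ∸ sizeF ts) d r S
          (subst (Kills _ _) (cong (lbl +_) (sym (m+[n∸m]≡n ts≤k))) K)

  Spine-opF-last : ∀ {u u'} lbl ts G d → Dead u lbl (sizeF ts) → u (lbl + sizeF ts) ≡ true →
    Spine u (suc (lbl + sizeF ts)) G → Kills u u' (lbl + (sizeF ts + d)) →
    Spine u' lbl (ts ++ opF d (node G ∷ []))
  Spine-opF-last {u} {u'} lbl ts G zero d _ (dead dG) K =
    dead (subst (Dead u' lbl) (sym size-eq)
      (Dead-join (Dead-mono dead-stays d) root-killed (Dead-mono dead-stays dG)))
    where
    open Kills K
    root-killed : u' (lbl + sizeF ts) ≡ false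
    root-killed = subst (λ z → u' (lbl + z) ≡ false) (+-identityʳ (sizeF ts)) killed
    size-eq : sizeF (ts ++ opF 0 (node G ∷ [])) ≡ suc (sizeF ts + sizeF G)
    size-eq = trans (sizeF-++ ts _) (trans (cong (sizeF ts +_) (sizeF-opF 0 (node G ∷ [])))
                (trans (sym (sizeF-++ ts _)) (sizeF-snoc ts G)))
  Spine-opF-last {u} {u'} lbl ts .(cs ++ node G' ∷ []) zero d _ (spine {ts = cs} {G'} dcs r S) K
    rewrite opF-zero-snoc cs (node G') | sym (List.++-assoc ts (node cs ∷ []) (node G' ∷ [])) =
    spine-resize (sizeF-snoc ts cs)
      (Dead-join (Dead-mono dead-stays d) root-killed (Dead-mono dead-stays dcs))
      (subst (λ z → u' z ≡ true) (sym shift) (alive-stays _ (>⇒≢ v<r) r))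
      (subst (λ z → Spine u' (suc z) G') (sym shift)
        (Spine-weaken S dead-stays (λ x le → alive-stays x (>⇒≢ (<-≤-trans (<-trans v<r (n<1+n _)) le)))))
    where
    open Kills K
    s = sizeF ts
    c = sizeF cs
    v≡ : lbl + (s + 0) ≡ lbl + s
    v≡ = cong (lbl +_) (+-identityʳ s)
    root-killed : u' (lbl + s) ≡ false
    root-killed = subst (λ z → u' z ≡ false) v≡ killed
    shift : lbl + suc (s + c) ≡ suc (lbl + s) + c
    shift = +-suc-assoc lbl s c
    v<r : lbl + (s + 0) < suc (lbl + s) + c
    v<r = ≤-<-trans (≤-reflexive v≡) (s≤s (m≤m+n (lbl + s) c))
  Spine-opF-last {u} {u'} lbl ts G (suc k) d r S K rewrite opF-suc-root k G =
    spine (Dead-mono dead-stays d) (alive-stays _ (<⇒≢ (+-monoʳ-< lbl (m<m+n (sizeF ts) z<s))) r)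
      (Spine-opF (suc (lbl + sizeF ts)) k G S (subst (Kills u u') shift K))
    where
    open Kills K
    shift : lbl + (sizeF ts + suc k) ≡ suc (lbl + sizeF ts) + k
    shift = trans (cong (lbl +_) (+-suc (sizeF ts) k)) (+-suc-assoc lbl (sizeF ts) k)

nth-parentsF-snoc : ∀ lbl par ts G l → lbl + sizeF ts ≤ l →
  nth (parentsF lbl par (ts ++ node G ∷ [])) (l ∸ lbl)
    ≡ nth (parentsT (lbl + sizeF ts) par (node G)) (l ∸ (lbl + sizeF ts))
nth-parentsF-snoc lbl par ts G l root≤l = begin
  nth (parentsF lbl par (ts ++ node G ∷ [])) (l ∸ lbl)
    ≡⟨ cong (λ P → nth P (l ∸ lbl)) (parentsF-++ lbl par ts (node G ∷ [])) ⟩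
  nth (parentsF lbl par ts ++ parentsT root par (node G) ++ []) (l ∸ lbl)
    ≡⟨ nth-++ʳ (parentsF lbl par ts) _ (l ∸ lbl) ts≤ ⟩
  nth (parentsT root par (node G) ++ []) (l ∸ lbl ∸ length (parentsF lbl par ts))
    ≡⟨ cong₂ nth (List.++-identityʳ (parentsT root par (node G)))
                 (trans (cong (l ∸ lbl ∸_) (length-parentsF lbl par ts)) (∸-+-assoc l lbl (sizeF ts))) ⟩
  nth (parentsT root par (node G)) (l ∸ root) ∎
  where
  open ≡-Reasoning
  root = lbl + sizeF ts
  ts≤ : length (parentsF lbl par ts) ≤ l ∸ lbl
  ts≤ = subst (_≤ l ∸ lbl) (trans (m+n∸m≡n lbl (sizeF ts)) (sym (length-parentsF lbl par ts)))
              (∸-monoˡ-≤ lbl root≤l)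

m∸n≡1+[m∸1+n] : ∀ {m n} → n < m → m ∸ n ≡ suc (m ∸ suc n)
m∸n≡1+[m∸1+n] {suc m} {zero}  _         = refl
m∸n≡1+[m∸1+n] {suc m} {suc n} (s≤s n<m) = m∸n≡1+[m∸1+n] n<m

-- When k precedes the forest it can only be the parent par of the whole forest.
Spine-parent : ∀ {u lbl par F} → Spine u lbl F → ∀ {k l} → lbl ≤ l → l < lbl + sizeF F →
  u l ≡ true → u k ≡ true → k < l → (∀ i → k < i → i < l → u i ≡ false) →
  lbl ≤ k ⊎ par ≡ just k → nth (parentsF lbl par F) (l ∸ lbl) ≡ just (just k)
Spine-parent (dead d) lbl≤l l< ul _ _ _ _ = contradiction (trans (sym ul) (d _ lbl≤l l<)) λ ()
Spine-parent {u} {lbl} {par} (spine {ts = ts} {G} d r S) {k} {l} lbl≤l l< ul uk k<l between k-pos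
  with <-≤-connex l (lbl + sizeF ts)
... | inj₁ l<root = contradiction (trans (sym ul) (d l lbl≤l l<root)) λ ()
... | inj₂ root≤l rewrite nth-parentsF-snoc lbl par ts G l root≤l with m≤n⇒m<n∨m≡n root≤l
...   | inj₂ refl rewrite n∸n≡0 (lbl + sizeF ts) = cong just (par≡k k-pos)
  where
  par≡k : lbl ≤ k ⊎ par ≡ just k → par ≡ just k
  par≡k (inj₂ e)     = e
  par≡k (inj₁ lbl≤k) = contradiction (trans (sym uk) (d k lbl≤k k<l)) λ ()
...   | inj₁ root<l rewrite m∸n≡1+[m∸1+n] root<l =
  Spine-parent S root<l (subst (l <_) (trans (cong (lbl +_) (sizeF-snoc ts G)) (+-suc-assoc lbl _ _)) l<)
    ul uk k<l between k-pos′
  where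
  root = lbl + sizeF ts
  k-pos′ : suc root ≤ k ⊎ just root ≡ just k
  k-pos′ with <-≤-connex k root
  ... | inj₁ k<root = contradiction (trans (sym r) (between root k<root root<l)) λ ()
  ... | inj₂ root≤k with m≤n⇒m<n∨m≡n root≤k
  ...   | inj₁ root<k = inj₁ root<k
  ...   | inj₂ root≡k = inj₂ (cong just root≡k)

mutual
  parentsT-opT : ∀ k t lbl par i → i ≤ k → nth (parentsF lbl par (opT k t)) i ≡ nth (parentsT lbl par t) i
  parentsT-opT zero (node cs) lbl par zero z≤n with splitLast cs | splitLast-view cs
  ... | nothing        | empty        = refl
  ... | just (ini , c) | snoc .ini .c = refl
  parentsT-opT (suc k) (node cs) lbl par zero    _         = refl
  parentsT-opT (suc k) (node cs) lbl par (suc i) (s≤s i≤k)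
    rewrite List.++-identityʳ (parentsF (suc lbl) (just lbl) (opF k cs)) = parentsF-opF k cs (suc lbl) (just lbl) i i≤k

  parentsF-opF : ∀ k F lbl par i → i ≤ k → nth (parentsF lbl par (opF k F)) i ≡ nth (parentsF lbl par F) i
  parentsF-opF k []       lbl par i _   = refl
  parentsF-opF k (t ∷ ts) lbl par i i≤k with <-≤-connex k (size t)
  ... | inj₁ k<t rewrite opF-∷-< ts k<t | parentsF-++ lbl par (opT k t) ts
                       | nth-parentsF-∷-< lbl par t ts i (≤-<-trans i≤k k<t) =
        trans (nth-++ˡ (parentsF lbl par (opT k t)) _ i
                 (subst (i <_) (sym (trans (length-parentsF lbl par (opT k t)) (sizeF-opT k t))) (≤-<-trans i≤k k<t)))
              (parentsT-opT k t lbl par i i≤k)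
  ... | inj₂ t≤k rewrite opF-∷-≥ ts t≤k with <-≤-connex i (size t)
  ...   | inj₁ i<t rewrite nth-parentsF-∷-< lbl par t (opF (k ∸ size t) ts) i i<t
                       | nth-parentsF-∷-< lbl par t ts i i<t = refl
  ...   | inj₂ t≤i rewrite nth-parentsF-∷-≥ lbl par t (opF (k ∸ size t) ts) i t≤i
                       | nth-parentsF-∷-≥ lbl par t ts i t≤i =
          parentsF-opF (k ∸ size t) ts (lbl + size t) par (i ∸ size t) (∸-monoˡ-≤ (size t) i≤k)

parentList-ungarFrom : ∀ bs i F j → j ≤ i → nth (parentList (ungarFrom i F bs)) j ≡ nth (parentList F) j
parentList-ungarFrom []           i F j _   = refl
parentList-ungarFrom (true ∷ bs)  i F j j≤i =
  trans (parentList-ungarFrom bs (suc i) (opF i F) j (≤-trans j≤i (n≤1+n i))) (parentsF-opF i F 1 nothing j j≤i)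
parentList-ungarFrom (false ∷ bs) i F j j≤i = parentList-ungarFrom bs (suc i) F j (≤-trans j≤i (n≤1+n i))

ungarFrom-++ : ∀ xs ys i F → ungarFrom i F (xs ++ ys) ≡ ungarFrom (i + length xs) (ungarFrom i F xs) ys
ungarFrom-++ []           ys i F rewrite +-identityʳ i = refl
ungarFrom-++ (true ∷ xs)  ys i F rewrite +-suc i (length xs) = ungarFrom-++ xs ys (suc i) (opF i F)
ungarFrom-++ (false ∷ xs) ys i F rewrite +-suc i (length xs) = ungarFrom-++ xs ys (suc i) F

sizeF-ungarFrom : ∀ bs i F → sizeF (ungarFrom i F bs) ≡ sizeF F
sizeF-ungarFrom []           i F = refl
sizeF-ungarFrom (true ∷ bs)  i F = trans (sizeF-ungarFrom bs (suc i) (opF i F)) (sizeF-opF i F)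
sizeF-ungarFrom (false ∷ bs) i F = sizeF-ungarFrom bs (suc i) F

sizeF-hat1 : ∀ n → sizeF (hat1 n) ≡ n
sizeF-hat1 zero    = refl
sizeF-hat1 (suc n) = cong suc (trans (+-identityʳ _) (sizeF-hat1 n))

sizeF-stateAfter : ∀ n σ t → sizeF (stateAfter n σ t) ≡ n
sizeF-stateAfter n σ zero    = sizeF-hat1 n
sizeF-stateAfter n σ (suc t) = trans (sizeF-ungarFrom (toList (σ (suc t))) 0 _) (sizeF-stateAfter n σ t)

≡ᵇ-refl : ∀ x → (x ≡ᵇ x) ≡ true
≡ᵇ-refl zero    = refl
≡ᵇ-refl (suc x) = ≡ᵇ-refl x

≢⇒≡ᵇ-false : ∀ {x y} → x ≢ y → (x ≡ᵇ y) ≡ false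
≢⇒≡ᵇ-false {zero}  {zero}  x≢y = contradiction refl x≢y
≢⇒≡ᵇ-false {zero}  {suc y} _   = refl
≢⇒≡ᵇ-false {suc x} {zero}  _   = refl
≢⇒≡ᵇ-false {suc x} {suc y} x≢y = ≢⇒≡ᵇ-false (x≢y ∘ cong suc)

not-∨ : ∀ x y → not (x ∨ y) ≡ not x ∧ not y
not-∨ true  y = refl
not-∨ false y = refl

-- Whether label x is selected by bs, whose first entry refers to label i + 1.
selectedFrom : ℕ → List Bool → ℕ → Bool
selectedFrom i []       x = false
selectedFrom i (b ∷ bs) x = (b ∧ (x ≡ᵇ suc i)) ∨ selectedFrom (suc i) bs x

selectedFrom-≤ : ∀ bs {i x} → x ≤ i → selectedFrom i bs x ≡ false
selectedFrom-≤ []       _   = refl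
selectedFrom-≤ (b ∷ bs) {i} x≤i rewrite ≢⇒≡ᵇ-false (<⇒≢ (s≤s x≤i)) | ∧-zeroʳ b =
  selectedFrom-≤ bs (≤-trans x≤i (n≤1+n i))

selectedFrom-nth : ∀ bs i j {b} → nth bs j ≡ just b → selectedFrom i bs (suc (i + j)) ≡ b
selectedFrom-nth (c ∷ bs) i zero eq
  rewrite +-identityʳ i | ≡ᵇ-refl i | selectedFrom-≤ bs (≤-refl {suc i}) | ∧-identityʳ c | ∨-identityʳ c =
  just-injective eq
selectedFrom-nth (c ∷ bs) i (suc j) eq
  rewrite ≢⇒≡ᵇ-false (>⇒≢ (m<m+n i (z<s {j}))) | ∧-zeroʳ c | +-suc i j =
  selectedFrom-nth bs (suc i) j eq

selected⇒selectedFrom : ∀ s {x b} → 1 ≤ x → Selected s x b → selectedFrom 0 s x ≡ b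
selected⇒selectedFrom s {suc x} _ sel = selectedFrom-nth s 0 x sel

selectedFrom-take : ∀ m bs {i x} → x ≤ i + m → selectedFrom i (take m bs) x ≡ selectedFrom i bs x
selectedFrom-take zero    bs       {i} {x} x≤ = sym (selectedFrom-≤ bs (subst (x ≤_) (+-identityʳ i) x≤))
selectedFrom-take (suc m) []               _  = refl
selectedFrom-take (suc m) (c ∷ bs) {i} {x} x≤ = cong (_ ∨_) (selectedFrom-take m bs (subst (x ≤_) (+-suc i m) x≤))

selectedFrom-take-> : ∀ m bs {i x} → i + m < x → selectedFrom i (take m bs) x ≡ false
selectedFrom-take-> zero    bs           _ = refl
selectedFrom-take-> (suc m) []           _ = refl
selectedFrom-take-> (suc m) (c ∷ bs) {i} {x} <x
  rewrite ≢⇒≡ᵇ-false (>⇒≢ (≤-<-trans (subst (suc i ≤_) (sym (+-suc i m)) (s≤s (m≤m+n i m))) <x)) | ∧-zeroʳ c =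
  selectedFrom-take-> m bs (subst (_< x) (+-suc i m) <x)

survivors : (ℕ → Bool) → List Bool → ℕ → Bool
survivors alive bs x = alive x ∧ not (selectedFrom 0 bs x)

Spine-ungarFrom : ∀ bs i {u F} → Spine u 1 F →
  Spine (λ x → u x ∧ not (selectedFrom i bs x)) 1 (ungarFrom i F bs)
Spine-ungarFrom []           i {u} S = Spine-cong (λ x → sym (∧-identityʳ (u x))) S
Spine-ungarFrom (false ∷ bs) i     S = Spine-ungarFrom bs (suc i) S
Spine-ungarFrom (true ∷ bs)  i {u} {F} S =
  Spine-cong (λ x → trans (∧-assoc (u x) _ _) (cong (u x ∧_) (sym (not-∨ (x ≡ᵇ suc i) _))))
    (Spine-ungarFrom bs (suc i) (Spine-opF 1 i F S kills))
  where
  kills : Kills u (λ x → u x ∧ not (x ≡ᵇ suc i)) (1 + i)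
  kills = record
    { dead-stays  = λ x ux → cong (_∧ _) ux
    ; alive-stays = λ x x≢ ux → trans (cong₂ _∧_ ux (cong not (≢⇒≡ᵇ-false x≢))) refl
    ; killed      = trans (cong (λ b → u (suc i) ∧ not b) (≡ᵇ-refl i)) (∧-zeroʳ (u (suc i)))
    }

-- When a move reaches vertex l, the operations of the move on earlier vertices have been
-- applied, and the later ones do not change the parent of l.
isChild-ungar-++ : ∀ {u F k l} a b → length a ≡ l → l < sizeF F → Spine u 1 F →
  survivors u a (suc l) ≡ true → survivors u a k ≡ true → 1 ≤ k → k < suc l →
  (∀ i → k < i → i < suc l → survivors u a i ≡ false) →
  IsChild (ungar F (a ++ b)) k (suc l)
isChild-ungar-++ {u} {F} {k} a b refl l<F S alive-l alive-k 1≤k k<l between = begin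
  nth (parentList (ungar F (a ++ b))) (length a)
    ≡⟨ cong (λ G → nth (parentList G) (length a)) (ungarFrom-++ a b 0 F) ⟩
  nth (parentList (ungarFrom (length a) M b)) (length a)
    ≡⟨ parentList-ungarFrom b (length a) M (length a) ≤-refl ⟩
  nth (parentList M) (length a)
    ≡⟨ Spine-parent (Spine-ungarFrom a 0 S) (s≤s z≤n) (s≤s (subst (length a <_) (sym (sizeF-ungarFrom a 0 F)) l<F))
         alive-l alive-k k<l between (inj₁ 1≤k) ⟩
  just (just k) ∎
  where
  open ≡-Reasoning
  M = ungarFrom 0 F a

hitBy : ∀ {n} → (ℕ → Vec Bool n) → ℕ → ℕ → Bool
hitBy σ zero    x = false
hitBy σ (suc t) x = hitBy σ t x ∨ selectedFrom 0 (toList (σ (suc t))) x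

Dead-empty : ∀ {u lbl} → Dead u lbl 0
Dead-empty {lbl = lbl} x lbl≤x x< = contradiction lbl≤x (<⇒≱ (subst (x <_) (+-identityʳ lbl) x<))

Spine-hat1 : ∀ n lbl → Spine (λ _ → true) lbl (hat1 n)
Spine-hat1 zero    lbl = dead Dead-empty
Spine-hat1 (suc n) lbl = spine {ts = []} Dead-empty refl (Spine-hat1 n _)

Spine-stateAfter : ∀ n σ t → Spine (λ x → not (hitBy σ t x)) 1 (stateAfter n σ t)
Spine-stateAfter n σ zero    = Spine-hat1 n 1
Spine-stateAfter n σ (suc t) = Spine-cong (λ x → sym (not-∨ (hitBy σ t x) _))
  (Spine-ungarFrom (toList (σ (suc t))) 0 (Spine-stateAfter n σ t))

hitBy-selected : ∀ {n} (σ : ℕ → Vec Bool n) {t t' x} → 1 ≤ t' → t' ≤ t →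
  selectedFrom 0 (toList (σ t')) x ≡ true → hitBy σ t x ≡ true
hitBy-selected σ {zero}  1≤t' t'≤0 _ = contradiction (≤-trans 1≤t' t'≤0) λ ()
hitBy-selected σ {suc t} {t'} {x} 1≤t' t'≤ sel with m≤n⇒m<n∨m≡n t'≤
... | inj₂ refl       = trans (cong (hitBy σ t x ∨_) sel) (∨-zeroʳ _)
... | inj₁ (s≤s t'≤t) = cong (_∨ selectedFrom 0 (toList (σ (suc t))) x) (hitBy-selected σ 1≤t' t'≤t sel)

hitBy-unselected : ∀ {n} (σ : ℕ → Vec Bool n) t x →
  (∀ t' → 1 ≤ t' → t' ≤ t → selectedFrom 0 (toList (σ t')) x ≡ false) → hitBy σ t x ≡ false
hitBy-unselected σ zero    x _     = refl
hitBy-unselected σ (suc t) x unsel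
  rewrite hitBy-unselected σ t x (λ t' 1≤t' t'≤t → unsel t' 1≤t' (≤-trans t'≤t (n≤1+n t))) =
  unsel (suc t) (s≤s z≤n) ≤-refl

firstHit-unselected : ∀ {n} (σ : ℕ → Vec Bool n) {x hx t} → 1 ≤ x → IsFirstHit n σ x hx → 1 ≤ t → t < hx →
  selectedFrom 0 (toList (σ t)) x ≡ false
firstHit-unselected σ {t = t} 1≤x (_ , _ , before) 1≤t t<hx =
  selected⇒selectedFrom (toList (σ t)) 1≤x (before t 1≤t t<hx)

hitBy-before-firstHit : ∀ {n} (σ : ℕ → Vec Bool n) {x hx t} → 1 ≤ x → IsFirstHit n σ x hx → t < hx →
  hitBy σ t x ≡ false
hitBy-before-firstHit σ {t = t} 1≤x first t<hx =
  hitBy-unselected σ t _ (λ t' 1≤t' t'≤t → firstHit-unselected σ 1≤x first 1≤t' (≤-<-trans t'≤t t<hx))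

hitBy-after-firstHit : ∀ {n} (σ : ℕ → Vec Bool n) {x hx t} → 1 ≤ x → IsFirstHit n σ x hx → hx ≤ t →
  hitBy σ t x ≡ true
hitBy-after-firstHit σ {hx = hx} 1≤x (1≤hx , at , _) hx≤t =
  hitBy-selected σ 1≤hx hx≤t (selected⇒selectedFrom (toList (σ hx)) 1≤x at)

isChild-at-firstHit : (n : ℕ) (σ : ℕ → Vec Bool n) (h : ℕ → ℕ) →
  (∀ i → 1 ≤ i → i ≤ n → IsFirstHit n σ i (h i)) →
  (k l : ℕ) → 1 ≤ k → k < l → l ≤ n → h l < h k → (∀ i → k < i → i < l → h i ≤ h l) →
  IsChild (stateAfter n σ (h l)) k l
isChild-at-firstHit n σ h first k (suc l) 1≤k k<l l≤n hl<hk between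
  with h (suc l) in hl≡ | proj₁ (first (suc l) (s≤s z≤n) l≤n)
... | suc t | _ = subst (λ S′ → IsChild (ungar F S′) k (suc l)) (List.take++drop≡id l S)
  (isChild-ungar-++ a (drop l S) length-a (subst (l <_) (sym (sizeF-stateAfter n σ t)) l≤n)
     (Spine-stateAfter n σ t) alive-l alive-k 1≤k k<l dead-between)
  where
  S = toList (σ (suc t))
  F = stateAfter n σ t
  a = take l S
  u = λ x → not (hitBy σ t x)
  first-at : ∀ {i} → 1 ≤ i → i ≤ suc l → IsFirstHit n σ i (h i)
  first-at 1≤i i≤l = first _ 1≤i (≤-trans i≤l l≤n)
  length-a : length a ≡ l
  length-a = trans (List.length-take l S)
    (m≤n⇒m⊓n≡m (subst (l ≤_) (sym (Vec.length-toList (σ (suc t)))) (≤-trans (n≤1+n l) l≤n)))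
  alive-l : survivors u a (suc l) ≡ true
  alive-l = cong₂ (λ p q → not p ∧ not q)
    (hitBy-before-firstHit σ z<s (first-at z<s ≤-refl) (subst (t <_) (sym hl≡) ≤-refl))
    (selectedFrom-take-> l S ≤-refl)
  alive-k : survivors u a k ≡ true
  alive-k = cong₂ (λ p q → not p ∧ not q)
    (hitBy-before-firstHit σ 1≤k (first-at 1≤k (<⇒≤ k<l)) (<-trans (n<1+n t) hl<hk))
    (trans (selectedFrom-take l S (≤-pred k<l))
      (firstHit-unselected σ 1≤k (first-at 1≤k (<⇒≤ k<l)) z<s hl<hk))
  dead-between : ∀ i → k < i → i < suc l → survivors u a i ≡ false
  dead-between i k<i i<l with m≤n⇒m<n∨m≡n (between i k<i i<l)
  ... | inj₁ (s≤s hi≤t) = cong (λ p → not p ∧ not (selectedFrom 0 a i))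
                              (hitBy-after-firstHit σ 1≤i (first-at 1≤i (<⇒≤ i<l)) hi≤t)
    where 1≤i = ≤-trans 1≤k (<⇒≤ k<i)
  ... | inj₂ hi≡ = trans (cong (λ q → u i ∧ not q) selected) (∧-zeroʳ (u i))
    where
    1≤i = ≤-trans 1≤k (<⇒≤ k<i)
    selected : selectedFrom 0 a i ≡ true
    selected = trans (selectedFrom-take l S (≤-pred i<l))
      (subst (λ T → selectedFrom 0 (toList (σ T)) i ≡ true) hi≡
        (selected⇒selectedFrom (toList (σ (h i))) 1≤i (proj₁ (proj₂ (first-at 1≤i (<⇒≤ i<l))))))

proposition4p9 :
    ((n : ℕ) (F : Forest) → InFord n F → (v : ℕ) → 1 ≤ v → v ≤ n →
      (a b c : ℕ) → a ≤ b → b ≤ c →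
      DescOrSelf F v a → DescOrSelf F v c → DescOrSelf F v b)
    ×
    ((p : ℚ) → 0ℚ <ℚ p → p ≤ℚ 1ℚ →
      (n m : ℕ) → 1 ≤ m → m ≤ n → (F G G' : Forest) → InFord n F →
      InFord (n ∸ m + 1) G → G ≡ induced m F → InFord (n ∸ m + 1) G' →
      probRU p n F (λ F' → eqF (induced m F') G')
        ≡ probRU p (n ∸ m + 1) G (λ G'' → eqF G'' G'))
    ×
    ((n : ℕ) (σ : ℕ → Vec Bool n) (h : ℕ → ℕ) →
      (∀ i → 1 ≤ i → i ≤ n → IsFirstHit n σ i (h i)) →
      (k l : ℕ) → 1 ≤ k → k < l → l ≤ n →
      h l < h k → (∀ i → k < i → i < l → h i ≤ h l) →
      IsChild (stateAfter n σ (h l)) k l)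
proposition4p9 =
  (λ n F _ v _ _ → descOrSelf-contiguous F) ,
  (λ p _ _ n m 1≤m m≤n F G G' _ _ G≡F⟨m⟩ _ →
     subst (λ H → probRU p n F (λ F' → eqF (induced m F') G') ≡ probRU p (n ∸ m + 1) H (λ G'' → eqF G'' G'))
       (sym G≡F⟨m⟩) (induced-commutes-with-ungar p n m 1≤m m≤n F G')) ,
  isChild-at-firstHit
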